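{- Let $b$ be a positive integer. If $(1,b,b+1)$ is an $abc$ triple, then $(1,b^{k},b^{k}+1)$ is an $abc$ triple for each positive odd integer $k$.
   Context: For a positive integer $n$, $\operatorname{rad}(n)$ denotes the product of the distinct prime factors of $n$. An $abc$ triple is a triple $(a,b,c)$ of relatively prime positive integers with $a+b=c$ and $\operatorname{rad}(abc)<c$. -}

module Defs where

open import Data.Nat using (ℕ; _+_; _*_; _<_)
open import Data.Nat.Divisibility using (_∣?_)
open import Data.Nat.Primality using (prime?)
open import Data.Nat.Coprimality using (Coprime)
open import Data.List using (List; filter; upTo)
open import Data.Nat.ListAction using (product)
open import Data.Product using (_×_)
open import Relation.Binary.PropositionalEquality using (_≡_)
open import Relation.Nullary.Decidable using (_×-dec_)

-- Every prime divisor of a positive n lies in [0, n], so we filter the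
-- list 0,1,...,n (upTo (n + 1)) for primes dividing n.  (rad 0 is not used.)
rad : ℕ → ℕ
rad n = product (filter (λ p → prime? p ×-dec (p ∣? n)) (upTo (n + 1)))

-- (a, b, c) is an abc triple: positive, relatively prime (pairwise coprime,
-- which is equivalent to gcd a b = 1 given a + b = c), a + b = c, rad(abc) < c.
record IsAbcTriple (a b c : ℕ) : Set where
  field
    a-pos    : 0 < a
    b-pos    : 0 < b
    c-pos    : 0 < c
    coprime  : Coprime a b × Coprime a c × Coprime b c
    sum-eq   : a + b ≡ c
    rad-lt   : rad (a * b * c) < c

-- Write B = b ^ k with k odd.  Then b + 1 divides B + 1, say B + 1 = e (b + 1).
-- The radical is submultiplicative, multiplicative on coprime factors, and satisfies
-- rad (b ^ k) ≤ rad b and rad e ≤ e; hence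
--   rad (B (B + 1)) ≤ rad b · rad e · rad (b + 1) ≤ e · rad (b (b + 1)) < e (b + 1) = B + 1.
module Submission where

open import Defs
open import Data.Nat
  using (ℕ; zero; suc; _+_; _*_; _^_; _≤_; _<_; z<s; s≤s; NonZero; >-nonZero; nonTrivial⇒n>1; nonTrivial⇒≢1)
open import Data.Nat.Properties
open import Data.Nat.Divisibility
open import Data.Nat.Primality using (Prime; prime; prime?; euclidsLemma; prime⇒irreducible)
open import Data.Nat.Coprimality using (Coprime; coprime⇒gcd≡1; coprime-+; 1-coprimeTo)
  renaming (sym to coprime-sym)
open import Data.Nat.LCM using (lcm; gcd*lcm; lcm-least)
open import Data.Nat.ListAction using (product)
open import Data.Nat.ListAction.Properties using (product-++)
open import Data.List using (List; []; _∷_; _∷ʳ_; [_]; filter; upTo; map)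
open import Data.List.Properties using (map-++; upTo-∷ʳ)
open import Data.List.Relation.Unary.All using (All; []; _∷_)
open import Data.List.Relation.Unary.AllPairs using (_∷_)
open import Data.List.Relation.Unary.Unique.Propositional using (Unique)
open import Data.List.Relation.Unary.Unique.Propositional.Properties using (upTo⁺)
open import Data.Product using (_×_; _,_)
open import Data.Sum using (inj₁; inj₂)
open import Relation.Nullary using (yes; no; ¬_; contradiction)
open import Relation.Nullary.Decidable using (_×-dec_)
open import Relation.Binary.PropositionalEquality hiding ([_])
open import Data.Nat.Tactic.RingSolver using (solve-∀)

private
  variable
    b e k m n p q y : ℕ
    xs : List ℕ

prime⇒≢1 : Prime p → p ≢ 1
prime⇒≢1 (prime _) = nonTrivial⇒≢1

prime∤1 : Prime p → ¬ p ∣ 1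
prime∤1 pp p∣1 = prime⇒≢1 pp (∣1⇒≡1 p∣1)

prime∤⇒coprime : Prime p → ¬ p ∣ n → Coprime p n
prime∤⇒coprime pp p∤n (d∣p , d∣n) with prime⇒irreducible pp d∣p
... | inj₁ d≡1 = d≡1
... | inj₂ refl = contradiction d∣n p∤n

n⊥n+1 : ∀ n → Coprime n (n + 1)
n⊥n+1 n = coprime-sym (coprime-+ (1-coprimeTo n))

coprime⇒*∣ : Coprime m n → m ∣ q → n ∣ q → m * n ∣ q
coprime⇒*∣ {m} {n} {q} cop m∣q n∣q = subst (_∣ q) lcm≡m*n (lcm-least m∣q n∣q)
  where
  lcm≡m*n : lcm m n ≡ m * n
  lcm≡m*n = trans (sym (*-identityˡ (lcm m n)))
                  (trans (cong (_* lcm m n) (sym (coprime⇒gcd≡1 cop))) (gcd*lcm m n))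

prime∣^⇒prime∣ : ∀ k → Prime p → p ∣ n ^ k → p ∣ n
prime∣^⇒prime∣ zero    pp p∣1 = contradiction p∣1 (prime∤1 pp)
prime∣^⇒prime∣ {n = n} (suc k) pp p∣n^k+1 with euclidsLemma n (n ^ k) pp p∣n^k+1
... | inj₁ p∣n   = p∣n
... | inj₂ p∣n^k = prime∣^⇒prime∣ k pp p∣n^k

product-map-mono-≤ : ∀ {g h : ℕ → ℕ} → (∀ x → g x ≤ h x) → ∀ xs →
                     product (map g xs) ≤ product (map h xs)
product-map-mono-≤ g≤h []       = ≤-refl
product-map-mono-≤ g≤h (x ∷ xs) = *-mono-≤ (g≤h x) (product-map-mono-≤ g≤h xs)

product-map-* : ∀ (g h : ℕ → ℕ) xs →
                product (map (λ x → g x * h x) xs) ≡ product (map g xs) * product (map h xs)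
product-map-* g h []       = refl
product-map-* g h (x ∷ xs) =
  trans (cong (g x * h x *_) (product-map-* g h xs)) ([m*n]*[o*p]≡[m*o]*[n*p] (g x) (h x) _ _)

radFactor : ℕ → ℕ → ℕ
radFactor n p with prime? p ×-dec p ∣? n
... | yes _ = p
... | no  _ = 1

radFactor-prime∣ : Prime p → p ∣ n → radFactor n p ≡ p
radFactor-prime∣ {p} {n} pp p∣n with prime? p ×-dec p ∣? n
... | yes _ = refl
... | no ¬q = contradiction (pp , p∣n) ¬q

radFactor-¬prime∣ : ¬ (Prime p × p ∣ n) → radFactor n p ≡ 1
radFactor-¬prime∣ {p} {n} ¬q with prime? p ×-dec p ∣? n
... | yes q = contradiction q ¬q
... | no  _ = refl

radFactor>0 : ∀ n p → 0 < radFactor n p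
radFactor>0 n p with prime? p ×-dec p ∣? n
... | yes (prime _ , _) = <-trans z<s (nonTrivial⇒n>1 p)
... | no  _             = z<s

prime∣radFactor⇒≡ : Prime q → q ∣ radFactor n p → q ≡ p
prime∣radFactor⇒≡ {q} {n} {p} pq q∣r with prime? p ×-dec p ∣? n
... | no  _ = contradiction q∣r (prime∤1 pq)
... | yes (pp , _) with prime⇒irreducible pp q∣r
...   | inj₁ q≡1 = contradiction q≡1 (prime⇒≢1 pq)
...   | inj₂ q≡p = q≡p

radFactor-*-≤ : ∀ m n p → radFactor (m * n) p ≤ radFactor m p * radFactor n p
radFactor-*-≤ m n p with prime? p ×-dec p ∣? (m * n)
... | no _ = *-mono-≤ (radFactor>0 m p) (radFactor>0 n p)
... | yes (pp , p∣mn) with euclidsLemma m n pp p∣mn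
...   | inj₁ p∣m rewrite radFactor-prime∣ pp p∣m = m≤m*n p _ {{>-nonZero (radFactor>0 n p)}}
...   | inj₂ p∣n rewrite radFactor-prime∣ pp p∣n = m≤n*m p _ {{>-nonZero (radFactor>0 m p)}}

radFactor-*-≥ : Coprime m n → ∀ p → radFactor m p * radFactor n p ≤ radFactor (m * n) p
radFactor-*-≥ {m} {n} cop p with prime? p ×-dec p ∣? m | prime? p ×-dec p ∣? n
... | yes (pp , p∣m) | yes (_ , p∣n) = contradiction (cop (p∣m , p∣n)) (prime⇒≢1 pp)
... | yes (pp , p∣m) | no _ =
  ≤-reflexive (trans (*-identityʳ p) (sym (radFactor-prime∣ pp (∣-trans p∣m (m∣m*n n)))))
... | no _ | yes (pp , p∣n) =
  ≤-reflexive (trans (*-identityˡ p) (sym (radFactor-prime∣ pp (∣-trans p∣n (n∣m*n m)))))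
... | no _ | no _ = radFactor>0 (m * n) p

radFactor-^-≤ : ∀ n k p → radFactor (n ^ k) p ≤ radFactor n p
radFactor-^-≤ n k p with prime? p ×-dec p ∣? (n ^ k)
... | yes (pp , p∣n^k) = ≤-reflexive (sym (radFactor-prime∣ pp (prime∣^⇒prime∣ k pp p∣n^k)))
... | no  _            = radFactor>0 n p

radOver : List ℕ → ℕ → ℕ
radOver xs n = product (map (radFactor n) xs)

product-filter≡radOver : ∀ n xs → product (filter (λ p → prime? p ×-dec p ∣? n) xs) ≡ radOver xs n
product-filter≡radOver n []       = refl
-- The filter only reduces once both decisions are split, so ×-dec cannot be used here.
product-filter≡radOver n (x ∷ xs) with prime? x | x ∣? n
... | yes _ | yes _ = cong (x *_) (product-filter≡radOver n xs)
... | yes _ | no  _ = trans (product-filter≡radOver n xs) (sym (+-identityʳ _))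
... | no  _ | yes _ = trans (product-filter≡radOver n xs) (sym (+-identityʳ _))
... | no  _ | no  _ = trans (product-filter≡radOver n xs) (sym (+-identityʳ _))

radOver-*-≤ : ∀ xs m n → radOver xs (m * n) ≤ radOver xs m * radOver xs n
radOver-*-≤ xs m n = ≤-trans (product-map-mono-≤ (radFactor-*-≤ m n) xs)
                             (≤-reflexive (product-map-* (radFactor m) (radFactor n) xs))

radOver-*-≥ : Coprime m n → ∀ xs → radOver xs m * radOver xs n ≤ radOver xs (m * n)
radOver-*-≥ {m} {n} cop xs =
  ≤-trans (≤-reflexive (sym (product-map-* (radFactor m) (radFactor n) xs)))
          (product-map-mono-≤ (radFactor-*-≥ cop) xs)

radOver-^-≤ : ∀ xs n k → radOver xs (n ^ k) ≤ radOver xs n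
radOver-^-≤ xs n k = product-map-mono-≤ (radFactor-^-≤ n k) xs

prime∤radOver : Prime p → All (p ≢_) xs → ¬ p ∣ radOver xs n
prime∤radOver pp []                   p∣1 = prime∤1 pp p∣1
prime∤radOver {xs = x ∷ xs} {n} pp (p≢x ∷ p∉xs) p∣r
  with euclidsLemma (radFactor n x) (radOver xs n) pp p∣r
... | inj₁ p∣rx = p≢x (prime∣radFactor⇒≡ pp p∣rx)
... | inj₂ p∣rs = prime∤radOver pp p∉xs p∣rs

radOver∣ : Unique xs → radOver xs n ∣ n
radOver∣ {[]}     {n} _ = 1∣ n
radOver∣ {x ∷ xs} {n} (x∉xs ∷ u) with prime? x ×-dec x ∣? n
... | yes (px , x∣n) = coprime⇒*∣ (prime∤⇒coprime px (prime∤radOver px x∉xs)) x∣n (radOver∣ u)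
... | no  _          = subst (_∣ n) (sym (+-identityʳ _)) (radOver∣ u)

radOver≤ : Unique xs → .{{NonZero n}} → radOver xs n ≤ n
radOver≤ u = ∣⇒≤ (radOver∣ u)

radOver-∷ʳ : ∀ xs → ¬ (Prime y × y ∣ n) → radOver (xs ∷ʳ y) n ≡ radOver xs n
radOver-∷ʳ {y} {n} xs ¬q = begin
  product (map (radFactor n) (xs ∷ʳ y))          ≡⟨ cong product (map-++ (radFactor n) xs [ y ]) ⟩
  product (map (radFactor n) xs ∷ʳ radFactor n y) ≡⟨ product-++ (map (radFactor n) xs) [ radFactor n y ] ⟩
  radOver xs n * (radFactor n y * 1)             ≡⟨ cong (λ r → radOver xs n * (r * 1)) (radFactor-¬prime∣ ¬q) ⟩
  radOver xs n * 1                               ≡⟨ *-identityʳ _ ⟩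
  radOver xs n                                   ∎
  where open ≡-Reasoning

-- Beyond n no further prime divides n, so rad n can be computed over any longer initial segment.
rad≡radOver-upTo : ∀ {n N} → 0 < n → n < N → rad n ≡ radOver (upTo N) n
rad≡radOver-upTo {n} {suc N} n>0 (s≤s n≤N) with m≤n⇒m<n∨m≡n n≤N
... | inj₂ refl =
  trans (product-filter≡radOver n (upTo (n + 1))) (cong (λ M → radOver (upTo M) n) (+-comm n 1))
... | inj₁ n<N  = begin
  rad n                      ≡⟨ rad≡radOver-upTo n>0 n<N ⟩
  radOver (upTo N) n         ≡⟨ sym (radOver-∷ʳ (upTo N) N∤n) ⟩
  radOver (upTo N ∷ʳ N) n    ≡⟨ cong (λ ys → radOver ys n) (upTo-∷ʳ N) ⟩
  radOver (upTo (suc N)) n   ∎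
  where
  open ≡-Reasoning
  N∤n : ¬ (Prime N × N ∣ n)
  N∤n (_ , N∣n) = <⇒≱ n<N (∣⇒≤ {{>-nonZero n>0}} N∣n)

radOver-^-suc≤ : ∀ xs → Unique xs → .{{NonZero e}} → b ^ k + 1 ≡ e * (b + 1) →
                 radOver xs (b ^ k * (b ^ k + 1)) ≤ e * radOver xs (b * (b + 1))
radOver-^-suc≤ {e} {b} {k} xs u B+1≡e[b+1] = begin
  r (B * (B + 1))              ≤⟨ radOver-*-≤ xs B (B + 1) ⟩
  r B * r (B + 1)              ≡⟨ cong (λ c → r B * r c) B+1≡e[b+1] ⟩
  r B * r (e * (b + 1))        ≤⟨ *-mono-≤ (radOver-^-≤ xs b k) (radOver-*-≤ xs e (b + 1)) ⟩
  r b * (r e * r (b + 1))      ≤⟨ *-monoʳ-≤ (r b) (*-monoˡ-≤ (r (b + 1)) (radOver≤ u)) ⟩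
  r b * (e * r (b + 1))        ≡⟨ x*[y*z]≡y*[x*z] (r b) e (r (b + 1)) ⟩
  e * (r b * r (b + 1))        ≤⟨ *-monoʳ-≤ e (radOver-*-≥ (n⊥n+1 b) xs) ⟩
  e * r (b * (b + 1))          ∎
  where
  open ≤-Reasoning
  B = b ^ k
  r = radOver xs
  x*[y*z]≡y*[x*z] : ∀ x y z → x * (y * z) ≡ y * (x * z)
  x*[y*z]≡y*[x*z] = solve-∀

n*[n+1]>0 : 0 < n → 0 < n * (n + 1)
n*[n+1]>0 {suc _} _ = z<s

rad-^-lt : 0 < b → 0 < k → b + 1 ∣ b ^ k + 1 → rad (b * (b + 1)) < b + 1 →
           rad (b ^ k * (b ^ k + 1)) < b ^ k + 1
rad-^-lt {b} {k} _ _ (divides zero B+1≡0) _ = contradiction (trans (+-comm 1 (b ^ k)) B+1≡0) 1+n≢0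
rad-^-lt {b} {k} b>0 k>0 (divides e@(suc _) B+1≡e[b+1]) rad<b+1 = begin-strict
  rad (B * (B + 1))                 ≡⟨ rad≡radOver-upTo (n*[n+1]>0 B>0) (n<1+n _) ⟩
  radOver L (B * (B + 1))           ≤⟨ radOver-^-suc≤ {e = e} {b} {k} L (upTo⁺ N) B+1≡e[b+1] ⟩
  e * radOver L (b * (b + 1))       ≡⟨ cong (e *_) (sym (rad≡radOver-upTo (n*[n+1]>0 b>0) (s≤s bb+1≤BB+1))) ⟩
  e * rad (b * (b + 1))             <⟨ *-monoʳ-< e rad<b+1 ⟩
  e * (b + 1)                       ≡⟨ sym B+1≡e[b+1] ⟩
  B + 1                             ∎
  where
  open ≤-Reasoning
  B = b ^ k
  N = suc (B * (B + 1))
  L = upTo N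
  B>0 : 0 < B
  B>0 = m^n>0 b {{>-nonZero b>0}} k
  b≤B : b ≤ B
  b≤B = subst (_≤ B) (*-identityʳ b) (^-monoʳ-≤ b {{>-nonZero b>0}} k>0)
  bb+1≤BB+1 : b * (b + 1) ≤ B * (B + 1)
  bb+1≤BB+1 = *-mono-≤ b≤B (+-monoˡ-≤ 1 b≤B)

suc∣^odd+1 : ∀ b m → b + 1 ∣ b ^ (2 * m + 1) + 1
suc∣^odd+1 b zero    = subst (λ c → b + 1 ∣ c + 1) (sym (*-identityʳ b)) ∣-refl
suc∣^odd+1 b (suc m) = subst (λ j → b + 1 ∣ b ^ j + 1) (cong (_+ 1) (sym (*-suc 2 m))) b+1∣b²X+1
  where
  X = b ^ (2 * m + 1)
  regroup : ∀ b X → b * (b * (X + 1)) + (b + 1) ≡ b * (b + 1) + (b * (b * X) + 1)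
  regroup = solve-∀
  b+1∣b²[X+1] : b + 1 ∣ b * (b * (X + 1))
  b+1∣b²[X+1] = ∣-trans (suc∣^odd+1 b m) (∣-trans (n∣m*n b) (n∣m*n b))
  b+1∣b²X+1 : b + 1 ∣ b * (b * X) + 1
  b+1∣b²X+1 = ∣m+n∣m⇒∣n (subst (b + 1 ∣_) (regroup b X) (∣m∣n⇒∣m+n b+1∣b²[X+1] ∣-refl)) (n∣m*n b)

corollary2p5 : (b : ℕ) → 0 < b → IsAbcTriple 1 b (b + 1) →
    (m : ℕ) → IsAbcTriple 1 (b ^ (2 * m + 1)) (b ^ (2 * m + 1) + 1)
corollary2p5 b b>0 abc m = record
  { a-pos   = z<s
  ; b-pos   = m^n>0 b {{>-nonZero b>0}} odd
  ; c-pos   = subst (0 <_) (+-comm 1 (b ^ odd)) z<s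
  ; coprime = 1-coprimeTo _ , 1-coprimeTo _ , n⊥n+1 (b ^ odd)
  ; sum-eq  = +-comm 1 (b ^ odd)
  ; rad-lt  = subst (λ c → rad (c * (b ^ odd + 1)) < b ^ odd + 1) (sym (*-identityˡ (b ^ odd)))
                (rad-^-lt b>0 (subst (0 <_) (+-comm 1 (2 * m)) z<s) (suc∣^odd+1 b m)
                  (subst (λ c → rad (c * (b + 1)) < b + 1) (*-identityˡ b) (IsAbcTriple.rad-lt abc)))
  }
  where
  odd = 2 * m + 1
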